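{- For every integer $n\ge 1$, $N'(n,n-1,0)=\frac{n(n+1)}{2}-1$.
   Context: $\mathbb{Z}_4$ is the ring of integers modulo $4$; a $\mathbb{Z}_4$-code of length $n$ is a $\mathbb{Z}_4$-submodule of $\mathbb{Z}_4^n$. A code has type $4^{k_1}2^{k_2}$ if it is isomorphic as an abelian group to $\mathbb{Z}_4^{k_1}\times\mathbb{Z}_2^{k_2}$. Two codes of the same length are equivalent if one is obtained from the other by permuting coordinates and changing signs of some coordinates. The trivial extension of a code $C$ of length $n-1$ is $\{(c,0)\mid c\in C\}$ (for $n-1=0$, the only code is the zero module). $N'(n,k_1,k_2)$ denotes the number of equivalence classes of $\mathbb{Z}_4$-codes of length $n$ and type $4^{k_1}2^{k_2}$ none of whose members is equivalent to the trivial extension of a $\mathbb{Z}_4$-code of length $n-1$. -}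

module Defs where

open import Data.Nat using (ℕ; zero; suc; _+_; _*_; _∸_; _/_)
open import Data.Nat.DivMod using (_mod_)
open import Data.Fin using (Fin; toℕ)
open import Data.Fin.Permutation using (Permutation′; _⟨$⟩ʳ_)
open import Data.Vec using (Vec; []; _∷_; replicate; zipWith; map; tabulate; lookup; init; last; _∷ʳ_)
open import Data.Bool using (Bool; true; false; if_then_else_)
open import Data.Product using (Σ; _×_; _,_; ∃; ∃-syntax)
open import Data.Empty using (⊥)
open import Relation.Nullary using (¬_)
open import Relation.Binary.PropositionalEquality using (_≡_; _≢_)

ℤ₄ : Set
ℤ₄ = Fin 4

ℤ₂ : Set
ℤ₂ = Fin 2

_+₄_ : ℤ₄ → ℤ₄ → ℤ₄
a +₄ b = (toℕ a + toℕ b) mod 4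

_*₄_ : ℤ₄ → ℤ₄ → ℤ₄
a *₄ b = (toℕ a * toℕ b) mod 4

-₄_ : ℤ₄ → ℤ₄
-₄ a = (4 ∸ toℕ a) mod 4

_+₂_ : ℤ₂ → ℤ₂ → ℤ₂
a +₂ b = (toℕ a + toℕ b) mod 2

0₄ : ℤ₄
0₄ = Data.Fin.zero

Word : ℕ → Set
Word n = Vec ℤ₄ n

_⊕_ : ∀ {n} → Word n → Word n → Word n
_⊕_ = zipWith _+₄_

_·_ : ∀ {n} → ℤ₄ → Word n → Word n
a · w = map (a *₄_) w

Subset4 : ℕ → Set
Subset4 n = Word n → Bool

record IsCode {n : ℕ} (C : Subset4 n) : Set where
  field
    has-zero : C (replicate n 0₄) ≡ true
    closed-+ : ∀ u v → C u ≡ true → C v ≡ true → C (u ⊕ v) ≡ true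
    closed-· : ∀ a u → C u ≡ true → C (a · u) ≡ true

Grp : ℕ → ℕ → Set
Grp k₁ k₂ = Vec ℤ₄ k₁ × Vec ℤ₂ k₂

_⊞_ : ∀ {k₁ k₂} → Grp k₁ k₂ → Grp k₁ k₂ → Grp k₁ k₂
(x , y) ⊞ (x' , y') = zipWith _+₄_ x x' , zipWith _+₂_ y y'

-- C has type 4^k₁ 2^k₂: C ≅ ℤ₄^k₁ × ℤ₂^k₂ as abelian groups, i.e. there is an
-- injective group homomorphism ℤ₄^k₁ × ℤ₂^k₂ → ℤ₄ⁿ whose image is exactly C
HasType : ∀ {n} → Subset4 n → ℕ → ℕ → Set
HasType {n} C k₁ k₂ =
  Σ (Grp k₁ k₂ → Word n) λ φ →
    (∀ x y → φ (x ⊞ y) ≡ φ x ⊕ φ y) ×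
    (∀ x y → φ x ≡ φ y → x ≡ y) ×
    (∀ w → C w ≡ true → ∃[ x ] φ x ≡ w) ×
    (∀ x → C (φ x) ≡ true)

act : ∀ {n} → Permutation′ n → Vec Bool n → Word n → Word n
act σ s w = tabulate λ i →
  if lookup s i then -₄ lookup w (σ ⟨$⟩ʳ i) else lookup w (σ ⟨$⟩ʳ i)

Equivalent : ∀ {n} → Subset4 n → Subset4 n → Set
Equivalent {n} C D = ∃[ σ ] ∃[ s ] (∀ w → D w ≡ C (act {n} σ s w))

isZero : ℤ₄ → Bool
isZero Data.Fin.zero = true
isZero (Data.Fin.suc _) = false

_∧_ : Bool → Bool → Bool
true ∧ b = b
false ∧ b = false

trivialExt : ∀ {m} → Subset4 m → Subset4 (suc m)
trivialExt C w = C (init w) ∧ isZero (last w)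

Counted : (n k₁ k₂ : ℕ) → Subset4 n → Set
Counted zero k₁ k₂ C = IsCode C × HasType C k₁ k₂
Counted (suc m) k₁ k₂ C =
  IsCode C × HasType C k₁ k₂ ×
  ¬ (∃[ C' ] (IsCode {m} C' × Equivalent (trivialExt C') C))

-- "N'(n, k₁, k₂) = N": there are N representatives of the Counted codes,
-- pairwise inequivalent, such that every Counted code is equivalent to one of them
N'≡ : (n k₁ k₂ N : ℕ) → Set
N'≡ n k₁ k₂ N =
  Σ (Vec (Subset4 n) N) λ reps →
    (∀ i → Counted n k₁ k₂ (lookup reps i)) ×
    (∀ i j → i ≢ j → ¬ Equivalent (lookup reps i) (lookup reps j)) ×
    (∀ C → Counted n k₁ k₂ C → ∃[ i ] Equivalent (lookup reps i) C)

module Submission where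

-- A code C ⊆ ℤ₄^(m+1) of type 4^m is the image of an injective additive map ℤ₄^m → ℤ₄^(m+1).
-- Gaussian elimination around a unit pivot shows that such an image is the kernel
-- {w | v·w = 0} of a linear form v having a unit coordinate (kernelPresentation,
-- free-code-is-kernel).  The monomial action on words is adjoint to one on linear forms
-- (dot-act), which brings v to the standard form 1^A 2^B 0^(m+1-A-B) with A ≥ 1 (normal-form).
-- For (A , B) = (1 , 0) the kernel is a coordinate hyperplane, hence equivalent to a trivial
-- extension (hyperplane-is-trivial); every other such kernel has full support and so is not
-- (full-support⇒not-trivial).  A and B, the numbers of units and of 2s in v, are invariants of
-- the equivalence class (equivalent-kernels).  So the classes correspond to the pairs
-- (a , b) = (A - 1 , B) with 1 ≤ a + b ≤ m, of which there are m(m+3)/2 = (m+1)(m+2)/2 - 1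
-- (pair-enumeration, pairCount-formula); classification⇒N′ turns this into the count.

open import Defs
open import Data.Nat.Base using (ℕ; zero; suc; _+_; _*_; _∸_; _/_; _≤_; z≤n; s≤s)
open import Data.Nat.DivMod using (m*n/n≡m)
open import Data.Nat.Solver using (module +-*-Solver)
import Data.Nat.Properties as ℕP
open import Data.Fin.Base as F using (Fin; toℕ; fromℕ; fromℕ<; punchIn; splitAt; _↑ˡ_; _↑ʳ_)
open import Data.Fin.Permutation as Perm using (Permutation′; _⟨$⟩ʳ_; _⟨$⟩ˡ_)
open import Data.Fin.Patterns using (0F; 1F; 2F; 3F)
import Data.Fin.Properties as FinP
open FinP using (all?) renaming (_≟_ to _≟₄_)
open import Data.Vec.Base as V using (Vec; []; _∷_; replicate; tabulate; lookup; insertAt; removeAt)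
import Data.Vec.Properties as VecP
open import Data.Bool.Base using (Bool; true; false; if_then_else_)
import Data.Bool.Properties as BoolP
open import Data.Product.Base using (Σ-syntax; _×_; _,_; ∃; ∃-syntax; proj₁; proj₂)
open import Data.Empty using (⊥-elim)
open import Data.Sum.Base using (_⊎_; inj₁; inj₂; [_,_]′)
open import Relation.Nullary using (¬_; yes; no)
open import Relation.Nullary.Decidable using (from-yes; _→-dec_)
open import Relation.Binary.PropositionalEquality
open import Function.Base using (_∘_)
open import Function.Bundles using (mk⇔)
open import Algebra.Bundles using (CommutativeMonoid)
open import Level using (0ℓ)
import Algebra.Properties.CommutativeMonoid.Sum as Sum

open ≡-Reasoning

+₄-assoc : ∀ a b c → (a +₄ b) +₄ c ≡ a +₄ (b +₄ c)
+₄-assoc = from-yes (all? λ a → all? λ b → all? λ c → (a +₄ b) +₄ c ≟₄ a +₄ (b +₄ c))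

+₄-comm : ∀ a b → a +₄ b ≡ b +₄ a
+₄-comm = from-yes (all? λ a → all? λ b → a +₄ b ≟₄ b +₄ a)

+₄-identityˡ : ∀ a → 0₄ +₄ a ≡ a
+₄-identityˡ = from-yes (all? λ a → 0₄ +₄ a ≟₄ a)

+₄-identityʳ : ∀ a → a +₄ 0₄ ≡ a
+₄-identityʳ = from-yes (all? λ a → a +₄ 0₄ ≟₄ a)

+₄-left-comm : ∀ a b c → a +₄ (b +₄ c) ≡ b +₄ (a +₄ c)
+₄-left-comm = from-yes (all? λ a → all? λ b → all? λ c → a +₄ (b +₄ c) ≟₄ b +₄ (a +₄ c))

+₄-interchange : ∀ a b c d → (a +₄ b) +₄ (c +₄ d) ≡ (a +₄ c) +₄ (b +₄ d)
+₄-interchange = from-yes (all? λ a → all? λ b → all? λ c → all? λ d →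
  (a +₄ b) +₄ (c +₄ d) ≟₄ (a +₄ c) +₄ (b +₄ d))

-₄-distrib : ∀ a b → -₄ (a +₄ b) ≡ (-₄ a) +₄ (-₄ b)
-₄-distrib = from-yes (all? λ a → all? λ b → -₄ (a +₄ b) ≟₄ (-₄ a) +₄ (-₄ b))

*₄-zeroˡ : ∀ a → 0₄ *₄ a ≡ 0₄
*₄-zeroˡ = from-yes (all? λ a → 0₄ *₄ a ≟₄ 0₄)

*₄-zeroʳ : ∀ a → a *₄ 0₄ ≡ 0₄
*₄-zeroʳ = from-yes (all? λ a → a *₄ 0₄ ≟₄ 0₄)

*₄-identityˡ : ∀ a → 1F *₄ a ≡ a
*₄-identityˡ = from-yes (all? λ a → 1F *₄ a ≟₄ a)

*₄-identityʳ : ∀ a → a *₄ 1F ≡ a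
*₄-identityʳ = from-yes (all? λ a → a *₄ 1F ≟₄ a)

*₄-distribˡ : ∀ x a b → x *₄ (a +₄ b) ≡ (x *₄ a) +₄ (x *₄ b)
*₄-distribˡ = from-yes (all? λ x → all? λ a → all? λ b → x *₄ (a +₄ b) ≟₄ (x *₄ a) +₄ (x *₄ b))

*₄-distribʳ : ∀ a b y → (a +₄ b) *₄ y ≡ (a *₄ y) +₄ (b *₄ y)
*₄-distribʳ = from-yes (all? λ a → all? λ b → all? λ y → (a +₄ b) *₄ y ≟₄ (a *₄ y) +₄ (b *₄ y))

*₄-left-comm : ∀ x a y → x *₄ (a *₄ y) ≡ a *₄ (x *₄ y)
*₄-left-comm = from-yes (all? λ x → all? λ a → all? λ y → x *₄ (a *₄ y) ≟₄ a *₄ (x *₄ y))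

+₄-cancel : ∀ x a y → (x +₄ (a *₄ y)) +₄ ((-₄ a) *₄ y) ≡ x
+₄-cancel = from-yes (all? λ x → all? λ a → all? λ y → (x +₄ (a *₄ y)) +₄ ((-₄ a) *₄ y) ≟₄ x)

+₄-idempotent⇒0 : ∀ a → a +₄ a ≡ a → a ≡ 0₄
+₄-idempotent⇒0 0F _ = refl
+₄-idempotent⇒0 1F ()
+₄-idempotent⇒0 2F ()
+₄-idempotent⇒0 3F ()

isZero⇒0 : ∀ a → isZero a ≡ true → a ≡ 0₄
isZero⇒0 0F _ = refl
isZero⇒0 1F ()
isZero⇒0 2F ()
isZero⇒0 3F ()

isUnit : ℤ₄ → Bool
isUnit 0F = false
isUnit 1F = true
isUnit 2F = false
isUnit 3F = true

nonUnit⇒2-torsion : ∀ a → isUnit a ≡ false → 2F *₄ a ≡ 0₄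
nonUnit⇒2-torsion 0F _ = refl
nonUnit⇒2-torsion 1F ()
nonUnit⇒2-torsion 2F _ = refl
nonUnit⇒2-torsion 3F ()

-- a coordinate holding a unit u can be cleared by subtracting a multiple of u (u² = 1)
unit-clears : ∀ u a → isUnit u ≡ true → a +₄ ((-₄ (a *₄ u)) *₄ u) ≡ 0₄
unit-clears = from-yes (all? λ u → all? λ a →
  (isUnit u BoolP.≟ true) →-dec (a +₄ ((-₄ (a *₄ u)) *₄ u) ≟₄ 0₄))

unit-clears′ : ∀ u d → isUnit u ≡ true → ((-₄ (u *₄ d)) *₄ u) +₄ d ≡ 0₄
unit-clears′ = from-yes (all? λ u → all? λ d →
  (isUnit u BoolP.≟ true) →-dec (((-₄ (u *₄ d)) *₄ u) +₄ d ≟₄ 0₄))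

zeros : ∀ n → Word n
zeros n = replicate n 0₄

e : ∀ {n} → Fin n → Word n
e {suc n} 0F = 1F ∷ zeros n
e (F.suc j) = 0₄ ∷ e j

lookup-⊕ : ∀ {n} (x y : Word n) i → lookup (x ⊕ y) i ≡ lookup x i +₄ lookup y i
lookup-⊕ x y i = VecP.lookup-zipWith _+₄_ i x y

lookup-· : ∀ {n} a (x : Word n) i → lookup (a · x) i ≡ a *₄ lookup x i
lookup-· a x i = VecP.lookup-map i (a *₄_) x

⊕-identityʳ : ∀ {n} (x : Word n) → x ⊕ zeros n ≡ x
⊕-identityʳ = VecP.zipWith-identityʳ +₄-identityʳ

⊕-interchange : ∀ {n} (a b c d : Word n) → (a ⊕ b) ⊕ (c ⊕ d) ≡ (a ⊕ c) ⊕ (b ⊕ d)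
⊕-interchange [] [] [] [] = refl
⊕-interchange (a ∷ x) (b ∷ y) (c ∷ z) (d ∷ w) = cong₂ _∷_ (+₄-interchange a b c d) (⊕-interchange x y z w)

⊕-idempotent⇒zeros : ∀ {n} (x : Word n) → x ⊕ x ≡ x → x ≡ zeros n
⊕-idempotent⇒zeros [] _ = refl
⊕-idempotent⇒zeros (a ∷ x) p =
  cong₂ _∷_ (+₄-idempotent⇒0 a (cong V.head p)) (⊕-idempotent⇒zeros x (cong V.tail p))

·-zeros : ∀ {n} a → a · zeros n ≡ zeros n
·-zeros {zero} a = refl
·-zeros {suc n} a = cong₂ _∷_ (*₄-zeroʳ a) (·-zeros a)

·-zeroˡ : ∀ {n} (x : Word n) → 0₄ · x ≡ zeros n
·-zeroˡ [] = refl
·-zeroˡ (a ∷ x) = cong₂ _∷_ (*₄-zeroˡ a) (·-zeroˡ x)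

·-identityˡ : ∀ {n} (x : Word n) → 1F · x ≡ x
·-identityˡ [] = refl
·-identityˡ (a ∷ x) = cong₂ _∷_ (*₄-identityˡ a) (·-identityˡ x)

·-distribʳ : ∀ {n} a b (x : Word n) → (a +₄ b) · x ≡ (a · x) ⊕ (b · x)
·-distribʳ a b [] = refl
·-distribʳ a b (c ∷ x) = cong₂ _∷_ (*₄-distribʳ a b c) (·-distribʳ a b x)

⊕-cancel : ∀ {n} (x : Word n) a y → (x ⊕ (a · y)) ⊕ ((-₄ a) · y) ≡ x
⊕-cancel [] a [] = refl
⊕-cancel (b ∷ x) a (c ∷ y) = cong₂ _∷_ (+₄-cancel b a c) (⊕-cancel x a y)

removeAt-⊕ : ∀ {n} (x y : Word (suc n)) p → removeAt (x ⊕ y) p ≡ removeAt x p ⊕ removeAt y p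
removeAt-⊕ (a ∷ x) (b ∷ y) 0F = refl
removeAt-⊕ (a ∷ c ∷ x) (b ∷ d ∷ y) (F.suc p) = cong (a +₄ b ∷_) (removeAt-⊕ (c ∷ x) (d ∷ y) p)

reinsert-zero : ∀ {n} (x : Word (suc n)) p → lookup x p ≡ 0₄ → insertAt (removeAt x p) p 0₄ ≡ x
reinsert-zero x p xp≡0 = trans (cong (insertAt (removeAt x p) p) (sym xp≡0)) (VecP.insertAt-removeAt x p)

-- Additive maps between words are ℤ₄-linear

Additive : ∀ {m n} → (Word m → Word n) → Set
Additive φ = ∀ x y → φ (x ⊕ y) ≡ φ x ⊕ φ y

Injective : ∀ {m n} → (Word m → Word n) → Set
Injective φ = ∀ x y → φ x ≡ φ y → x ≡ y

module _ {m n} (φ : Word m → Word n) (additive : Additive φ) where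

  additive-zeros : φ (zeros m) ≡ zeros n
  additive-zeros = ⊕-idempotent⇒zeros (φ (zeros m))
    (trans (sym (additive (zeros m) (zeros m))) (cong φ (⊕-identityʳ (zeros m))))

  additive-one : ∀ x → φ (1F · x) ≡ 1F · φ x
  additive-one x = trans (cong φ (·-identityˡ x)) (sym (·-identityˡ (φ x)))

  one-more : ∀ a x → φ (a · x) ≡ a · φ x → φ ((1F +₄ a) · x) ≡ (1F +₄ a) · φ x
  one-more a x ih = begin
    φ ((1F +₄ a) · x)          ≡⟨ cong φ (·-distribʳ 1F a x) ⟩
    φ ((1F · x) ⊕ (a · x))     ≡⟨ additive (1F · x) (a · x) ⟩
    φ (1F · x) ⊕ φ (a · x)     ≡⟨ cong₂ _⊕_ (additive-one x) ih ⟩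
    (1F · φ x) ⊕ (a · φ x)     ≡⟨ ·-distribʳ 1F a (φ x) ⟨
    (1F +₄ a) · φ x            ∎

  -- every scalar is 0 or a sum of 1s, so additivity gives homogeneity
  additive-scalar : ∀ a x → φ (a · x) ≡ a · φ x
  additive-scalar 0F x = begin
    φ (0₄ · x)    ≡⟨ cong φ (·-zeroˡ x) ⟩
    φ (zeros m)   ≡⟨ additive-zeros ⟩
    zeros n       ≡⟨ ·-zeroˡ (φ x) ⟨
    0₄ · φ x      ∎
  additive-scalar 1F x = additive-one x
  additive-scalar 2F x = one-more 1F x (additive-one x)
  additive-scalar 3F x = one-more 2F x (additive-scalar 2F x)

+₄-commutativeMonoid : CommutativeMonoid 0ℓ 0ℓ
+₄-commutativeMonoid = record
  { Carrier = ℤ₄ ; _≈_ = _≡_ ; _∙_ = _+₄_ ; ε = 0₄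
  ; isCommutativeMonoid = record
    { isMonoid = record
      { isSemigroup = record
        { isMagma = record { isEquivalence = isEquivalence ; ∙-cong = cong₂ _+₄_ }
        ; assoc = +₄-assoc }
      ; identity = +₄-identityˡ , +₄-identityʳ }
    ; comm = +₄-comm } }

module Σ₄ = Sum +₄-commutativeMonoid

dot : ∀ {n} → Word n → Word n → ℤ₄
dot v w = Σ₄.sum (λ i → lookup v i *₄ lookup w i)

Kernel : ∀ {n} → Word n → Subset4 n
Kernel v w = isZero (dot v w)

dot-zerosʳ : ∀ {n} (v : Word n) → dot v (zeros n) ≡ 0₄
dot-zerosʳ [] = refl
dot-zerosʳ (x ∷ v) = trans (cong₂ _+₄_ (*₄-zeroʳ x) (dot-zerosʳ v)) (+₄-identityˡ 0₄)

dot-⊕ʳ : ∀ {n} (v u w : Word n) → dot v (u ⊕ w) ≡ dot v u +₄ dot v w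
dot-⊕ʳ v u w = trans (Σ₄.sum-cong-≗ distrib) (Σ₄.∑-distrib-+ vu vw)
  where
  vu vw : Fin _ → ℤ₄
  vu i = lookup v i *₄ lookup u i
  vw i = lookup v i *₄ lookup w i
  distrib : ∀ i → lookup v i *₄ lookup (u ⊕ w) i ≡ vu i +₄ vw i
  distrib i = trans (cong (lookup v i *₄_) (lookup-⊕ u w i)) (*₄-distribˡ (lookup v i) (lookup u i) (lookup w i))

dot-·ʳ : ∀ {n} (v : Word n) a w → dot v (a · w) ≡ a *₄ dot v w
dot-·ʳ [] a [] = sym (*₄-zeroʳ a)
dot-·ʳ (x ∷ v) a (y ∷ w) = begin
  (x *₄ (a *₄ y)) +₄ dot v (a · w)        ≡⟨ cong₂ _+₄_ (*₄-left-comm x a y) (dot-·ʳ v a w) ⟩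
  (a *₄ (x *₄ y)) +₄ (a *₄ dot v w)       ≡⟨ *₄-distribˡ a (x *₄ y) (dot v w) ⟨
  a *₄ ((x *₄ y) +₄ dot v w)              ∎

dot-e : ∀ {n} (v : Word n) j → dot v (e j) ≡ lookup v j
dot-e (x ∷ v) 0F = trans (cong₂ _+₄_ (*₄-identityʳ x) (dot-zerosʳ v)) (+₄-identityʳ x)
dot-e (x ∷ v) (F.suc j) = trans (cong₂ _+₄_ (*₄-zeroʳ x) (dot-e v j)) (+₄-identityˡ (lookup v j))

dot-insertAt : ∀ {n} (v : Word n) p α (w : Word (suc n)) →
  dot (insertAt v p α) w ≡ (α *₄ lookup w p) +₄ dot v (removeAt w p)
dot-insertAt v 0F α (y ∷ w) = refl
dot-insertAt (x ∷ v) (F.suc p) α (y ∷ z ∷ w) = begin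
  (x *₄ y) +₄ dot (insertAt v p α) (z ∷ w)
    ≡⟨ cong ((x *₄ y) +₄_) (dot-insertAt v p α (z ∷ w)) ⟩
  (x *₄ y) +₄ ((α *₄ lookup (z ∷ w) p) +₄ dot v (removeAt (z ∷ w) p))
    ≡⟨ +₄-left-comm (x *₄ y) (α *₄ lookup (z ∷ w) p) _ ⟩
  (α *₄ lookup (z ∷ w) p) +₄ ((x *₄ y) +₄ dot v (removeAt (z ∷ w) p)) ∎

Kernel-isCode : ∀ {n} (v : Word n) → IsCode (Kernel v)
Kernel-isCode {n} v = record
  { has-zero = cong isZero (dot-zerosʳ v)
  ; closed-+ = λ u w vu≡0 vw≡0 → cong isZero (begin
      dot v (u ⊕ w)         ≡⟨ dot-⊕ʳ v u w ⟩
      dot v u +₄ dot v w    ≡⟨ cong₂ _+₄_ (isZero⇒0 _ vu≡0) (isZero⇒0 _ vw≡0) ⟩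
      0₄                    ∎)
  ; closed-· = λ a u vu≡0 → cong isZero (begin
      dot v (a · u)         ≡⟨ dot-·ʳ v a u ⟩
      a *₄ dot v u          ≡⟨ cong (a *₄_) (isZero⇒0 _ vu≡0) ⟩
      a *₄ 0₄               ≡⟨ *₄-zeroʳ a ⟩
      0₄                    ∎)
  }

dot-insertAt-zero : ∀ {n} (v : Word n) p α (w : Word n) → dot (insertAt v p α) (insertAt w p 0₄) ≡ dot v w
dot-insertAt-zero v p α w = begin
  dot (insertAt v p α) (insertAt w p 0₄)
    ≡⟨ dot-insertAt v p α (insertAt w p 0₄) ⟩
  (α *₄ lookup (insertAt w p 0₄) p) +₄ dot v (removeAt (insertAt w p 0₄) p)
    ≡⟨ cong₂ (λ a z → (α *₄ a) +₄ dot v z) (VecP.insertAt-lookup w p 0₄) (VecP.removeAt-insertAt w p 0₄) ⟩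
  (α *₄ 0₄) +₄ dot v w
    ≡⟨ cong (_+₄ dot v w) (*₄-zeroʳ α) ⟩
  0₄ +₄ dot v w
    ≡⟨ +₄-identityˡ (dot v w) ⟩
  dot v w ∎

-- A free submodule of rank m in ℤ₄^(m+1) is cut out by one equation

HasUnit : ∀ {n} → Word n → Set
HasUnit v = ∃[ k ] isUnit (lookup v k) ≡ true

record KernelPresentation {m n} (φ : Word m → Word n) : Set where
  field
    normal       : Word n
    normal-unit  : HasUnit normal
    annihilates  : ∀ x → dot normal (φ x) ≡ 0₄
    cuts-out     : ∀ w → dot normal w ≡ 0₄ → ∃[ x ] φ x ≡ w

-- for m = 0 the image is {0}, the kernel of the form (1)
kernelPresentation₀ : (φ : Word 0 → Word 1) → Additive φ → KernelPresentation φ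
kernelPresentation₀ φ additive = record
  { normal = 1F ∷ [] ; normal-unit = 0F , refl ; annihilates = annihilates ; cuts-out = cuts-out }
  where
  annihilates : ∀ x → dot (1F ∷ []) (φ x) ≡ 0₄
  annihilates [] = cong (dot (1F ∷ [])) (additive-zeros φ additive)
  cuts-out : ∀ w → dot (1F ∷ []) w ≡ 0₄ → ∃[ x ] φ x ≡ w
  cuts-out (0F ∷ []) _ = [] , additive-zeros φ additive
  cuts-out (1F ∷ []) ()
  cuts-out (2F ∷ []) ()
  cuts-out (3F ∷ []) ()

no-unit⇒2-torsion : ∀ {n} (w : Word n) → (∀ k → isUnit (lookup w k) ≡ false) → 2F · w ≡ zeros n
no-unit⇒2-torsion [] _ = refl
no-unit⇒2-torsion (a ∷ w) no-unit =
  cong₂ _∷_ (nonUnit⇒2-torsion a (no-unit 0F)) (no-unit⇒2-torsion w (no-unit ∘ F.suc))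

-- injectivity forbids φ(e₀) from being 2-torsion, so φ(e₀) has a unit coordinate: the pivot
pivot : ∀ {m n} (φ : Word (suc m) → Word n) → Additive φ → Injective φ → HasUnit (φ (e 0F))
pivot {m} {n} φ additive injective with FinP.any? (λ k → isUnit (lookup (φ (e 0F)) k) BoolP.≟ true)
... | yes unit = unit
... | no no-unit = ⊥-elim (2≢0 (cong V.head 2e₀≡0))
  where
  2≢0 : ¬ (2F ≡ 0₄)
  2≢0 ()
  2e₀≡0 : 2F · e 0F ≡ zeros (suc m)
  2e₀≡0 = injective _ _ (begin
    φ (2F · e 0F)     ≡⟨ additive-scalar φ additive 2F (e 0F) ⟩
    2F · φ (e 0F)     ≡⟨ no-unit⇒2-torsion (φ (e 0F)) (λ k → BoolP.¬-not (λ unit → no-unit (k , unit))) ⟩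
    zeros n           ≡⟨ additive-zeros φ additive ⟨
    φ (zeros (suc m)) ∎)

split-head : ∀ {m} h (y : Word m) → h ∷ y ≡ (0₄ ∷ y) ⊕ (h · e 0F)
split-head h y = cong₂ _∷_ (sym (trans (+₄-identityˡ (h *₄ 1F)) (*₄-identityʳ h)))
                           (sym (trans (cong (y ⊕_) (·-zeros h)) (⊕-identityʳ y)))

tail-shift : ∀ {m} (y : Word m) a → V.tail ((0₄ ∷ y) ⊕ (a · e 0F)) ≡ y
tail-shift y a = trans (cong (y ⊕_) (·-zeros a)) (⊕-identityʳ y)

-- One step of Gaussian elimination.  Subtracting the right multiple of c = φ(e₀) clears the
-- pivot coordinate p; restricted to words starting with 0 and with coordinate p deleted, φ
-- becomes a map ℤ₄^m → ℤ₄^(m+1), and a kernel presentation of that map extends to one of φ.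
module Elimination {m} (φ : Word (suc m) → Word (suc (suc m))) (additive : Additive φ)
                   (p : Fin (suc (suc m))) (pivot-unit : isUnit (lookup (φ (e 0F)) p) ≡ true) where

  c : Word (suc (suc m))
  c = φ (e 0F)

  u : ℤ₄
  u = lookup c p

  coefficient : Word (suc (suc m)) → ℤ₄
  coefficient w = -₄ (lookup w p *₄ u)

  clear : Word (suc (suc m)) → Word (suc (suc m))
  clear w = w ⊕ (coefficient w · c)

  clear-pivot : ∀ w → lookup (clear w) p ≡ 0₄
  clear-pivot w = begin
    lookup (clear w) p                                   ≡⟨ lookup-⊕ w (coefficient w · c) p ⟩
    lookup w p +₄ lookup (coefficient w · c) p          ≡⟨ cong (lookup w p +₄_) (lookup-· (coefficient w) c p) ⟩
    lookup w p +₄ (coefficient w *₄ u)                  ≡⟨ unit-clears u (lookup w p) pivot-unit ⟩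
    0₄                                                   ∎

  clear-additive : ∀ A B → clear (A ⊕ B) ≡ clear A ⊕ clear B
  clear-additive A B = begin
    (A ⊕ B) ⊕ (coefficient (A ⊕ B) · c)
      ≡⟨ cong (λ a → (A ⊕ B) ⊕ ((-₄ (a *₄ u)) · c)) (lookup-⊕ A B p) ⟩
    (A ⊕ B) ⊕ ((-₄ ((lookup A p +₄ lookup B p) *₄ u)) · c)
      ≡⟨ cong (λ a → (A ⊕ B) ⊕ ((-₄ a) · c)) (*₄-distribʳ (lookup A p) (lookup B p) u) ⟩
    (A ⊕ B) ⊕ ((-₄ ((lookup A p *₄ u) +₄ (lookup B p *₄ u))) · c)
      ≡⟨ cong (λ a → (A ⊕ B) ⊕ (a · c)) (-₄-distrib (lookup A p *₄ u) (lookup B p *₄ u)) ⟩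
    (A ⊕ B) ⊕ ((coefficient A +₄ coefficient B) · c)
      ≡⟨ cong ((A ⊕ B) ⊕_) (·-distribʳ (coefficient A) (coefficient B) c) ⟩
    (A ⊕ B) ⊕ ((coefficient A · c) ⊕ (coefficient B · c))
      ≡⟨ ⊕-interchange A B (coefficient A · c) (coefficient B · c) ⟩
    clear A ⊕ clear B ∎

  shift : ∀ x a → φ (x ⊕ (a · e 0F)) ≡ φ x ⊕ (a · c)
  shift x a = trans (additive x (a · e 0F)) (cong (φ x ⊕_) (additive-scalar φ additive a (e 0F)))

  corrected : Word (suc m) → Word (suc m)
  corrected x = x ⊕ (coefficient (φ x) · e 0F)

  clear-image : ∀ x → clear (φ x) ≡ φ (corrected x)
  clear-image x = sym (shift x (coefficient (φ x)))

  reduced : Word m → Word (suc m)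
  reduced y = removeAt (clear (φ (0₄ ∷ y))) p

  reinsert-reduced : ∀ y → insertAt (reduced y) p 0₄ ≡ clear (φ (0₄ ∷ y))
  reinsert-reduced y = reinsert-zero (clear (φ (0₄ ∷ y))) p (clear-pivot (φ (0₄ ∷ y)))

  reduced-additive : Additive reduced
  reduced-additive y y′ = begin
    removeAt (clear (φ (x ⊕ x′))) p              ≡⟨ cong (λ z → removeAt (clear z) p) (additive x x′) ⟩
    removeAt (clear (φ x ⊕ φ x′)) p              ≡⟨ cong (λ z → removeAt z p) (clear-additive (φ x) (φ x′)) ⟩
    removeAt (clear (φ x) ⊕ clear (φ x′)) p      ≡⟨ removeAt-⊕ (clear (φ x)) (clear (φ x′)) p ⟩
    reduced y ⊕ reduced y′                        ∎
    where
    x x′ : Word (suc m)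
    x = 0₄ ∷ y
    x′ = 0₄ ∷ y′

  reduced-injective : Injective φ → Injective reduced
  reduced-injective injective y y′ eq = begin
    y                             ≡⟨ tail-shift y (coefficient (φ (0₄ ∷ y))) ⟨
    V.tail (corrected (0₄ ∷ y))   ≡⟨ cong V.tail (injective _ _ same-image) ⟩
    V.tail (corrected (0₄ ∷ y′))  ≡⟨ tail-shift y′ (coefficient (φ (0₄ ∷ y′))) ⟩
    y′                            ∎
    where
    same-image : φ (corrected (0₄ ∷ y)) ≡ φ (corrected (0₄ ∷ y′))
    same-image = begin
      φ (corrected (0₄ ∷ y))        ≡⟨ clear-image (0₄ ∷ y) ⟨
      clear (φ (0₄ ∷ y))            ≡⟨ reinsert-reduced y ⟨
      insertAt (reduced y) p 0₄     ≡⟨ cong (λ z → insertAt z p 0₄) eq ⟩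
      insertAt (reduced y′) p 0₄    ≡⟨ reinsert-reduced y′ ⟩
      clear (φ (0₄ ∷ y′))           ≡⟨ clear-image (0₄ ∷ y′) ⟩
      φ (corrected (0₄ ∷ y′))       ∎

  reinsert-clear : ∀ w → insertAt (removeAt (clear w) p) p 0₄ ≡ clear w
  reinsert-clear w = reinsert-zero (clear w) p (clear-pivot w)

  -- A kernel presentation v′ of the reduced map extends to φ by inserting at p the coordinate
  -- that makes the new normal v orthogonal to c; then v·w = v′·(reduced form of w).
  module Extension (K′ : KernelPresentation reduced) where
    open KernelPresentation K′ renaming
      (normal to v′; normal-unit to v′-unit; annihilates to v′-annihilates; cuts-out to v′-cuts-out)

    v : Word (suc (suc m))
    v = insertAt v′ p (-₄ (u *₄ dot v′ (removeAt c p)))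

    v-unit : HasUnit v
    v-unit = let (k , unit) = v′-unit in
      punchIn p k , trans (cong isUnit (VecP.insertAt-punchIn v′ p _ k)) unit

    v·c≡0 : dot v c ≡ 0₄
    v·c≡0 = trans (dot-insertAt v′ p _ c) (unit-clears′ u (dot v′ (removeAt c p)) pivot-unit)

    v·clear : ∀ w → dot v (clear w) ≡ dot v w
    v·clear w = begin
      dot v (w ⊕ (coefficient w · c))          ≡⟨ dot-⊕ʳ v w (coefficient w · c) ⟩
      dot v w +₄ dot v (coefficient w · c)     ≡⟨ cong (dot v w +₄_) (dot-·ʳ v (coefficient w) c) ⟩
      dot v w +₄ (coefficient w *₄ dot v c)    ≡⟨ cong (λ z → dot v w +₄ (coefficient w *₄ z)) v·c≡0 ⟩
      dot v w +₄ (coefficient w *₄ 0₄)         ≡⟨ cong (dot v w +₄_) (*₄-zeroʳ (coefficient w)) ⟩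
      dot v w +₄ 0₄                            ≡⟨ +₄-identityʳ (dot v w) ⟩
      dot v w                                  ∎

    v·≡v′·reduced : ∀ w → dot v w ≡ dot v′ (removeAt (clear w) p)
    v·≡v′·reduced w = begin
      dot v w                                          ≡⟨ v·clear w ⟨
      dot v (clear w)                                  ≡⟨ cong (dot v) (reinsert-clear w) ⟨
      dot v (insertAt (removeAt (clear w) p) p 0₄)     ≡⟨ dot-insertAt-zero v′ p _ (removeAt (clear w) p) ⟩
      dot v′ (removeAt (clear w) p)                    ∎

    v-annihilates : ∀ x → dot v (φ x) ≡ 0₄
    v-annihilates (h ∷ y) = begin
      dot v (φ (h ∷ y))                        ≡⟨ cong (dot v ∘ φ) (split-head h y) ⟩
      dot v (φ ((0₄ ∷ y) ⊕ (h · e 0F)))        ≡⟨ cong (dot v) (shift (0₄ ∷ y) h) ⟩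
      dot v (φ (0₄ ∷ y) ⊕ (h · c))             ≡⟨ dot-⊕ʳ v (φ (0₄ ∷ y)) (h · c) ⟩
      dot v (φ (0₄ ∷ y)) +₄ dot v (h · c)      ≡⟨ cong₂ _+₄_ (v·≡v′·reduced (φ (0₄ ∷ y))) (dot-·ʳ v h c) ⟩
      dot v′ (reduced y) +₄ (h *₄ dot v c)     ≡⟨ cong₂ (λ a b → a +₄ (h *₄ b)) (v′-annihilates y) v·c≡0 ⟩
      0₄ +₄ (h *₄ 0₄)                         ≡⟨ cong (0₄ +₄_) (*₄-zeroʳ h) ⟩
      0₄                                       ∎

    -- if v·w = 0 then w's reduced form is reduced y for some y, so w and φ(0 ∷ y) have the
    -- same cleared form; undoing the clearing writes w as an image of φ
    v-cuts-out : ∀ w → dot v w ≡ 0₄ → ∃[ x ] φ x ≡ w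
    v-cuts-out w v·w≡0 = corrected x₀ ⊕ (back · e 0F) , (begin
      φ (corrected x₀ ⊕ (back · e 0F))     ≡⟨ shift (corrected x₀) back ⟩
      φ (corrected x₀) ⊕ (back · c)        ≡⟨ cong (_⊕ (back · c)) (clear-image x₀) ⟨
      clear (φ x₀) ⊕ (back · c)            ≡⟨ cong (_⊕ (back · c)) same-clear ⟩
      clear w ⊕ (back · c)                 ≡⟨ ⊕-cancel w (coefficient w) c ⟩
      w                                    ∎)
      where
      back : ℤ₄
      back = -₄ coefficient w
      preimage : ∃[ y ] reduced y ≡ removeAt (clear w) p
      preimage = v′-cuts-out (removeAt (clear w) p) (trans (sym (v·≡v′·reduced w)) v·w≡0)
      x₀ : Word (suc m)
      x₀ = 0₄ ∷ proj₁ preimage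
      same-clear : clear (φ x₀) ≡ clear w
      same-clear = begin
        clear (φ x₀)                                 ≡⟨ reinsert-reduced (proj₁ preimage) ⟨
        insertAt (reduced (proj₁ preimage)) p 0₄     ≡⟨ cong (λ z → insertAt z p 0₄) (proj₂ preimage) ⟩
        insertAt (removeAt (clear w) p) p 0₄         ≡⟨ reinsert-clear w ⟩
        clear w                                      ∎

  extend : KernelPresentation reduced → KernelPresentation φ
  extend K′ = record { normal = v ; normal-unit = v-unit ; annihilates = v-annihilates ; cuts-out = v-cuts-out }
    where open Extension K′

kernelPresentation : ∀ {m} (φ : Word m → Word (suc m)) → Additive φ → Injective φ → KernelPresentation φ
kernelPresentation {zero} φ additive _ = kernelPresentation₀ φ additive
kernelPresentation {suc m} φ additive injective =
  let (p , pivot-unit) = pivot φ additive injective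
      open Elimination φ additive p pivot-unit
  in extend (kernelPresentation reduced reduced-additive (reduced-injective injective))

free-code-is-kernel : ∀ {m} (C : Subset4 (suc m)) → HasType C m 0 →
  ∃[ v ] HasUnit v × (∀ w → C w ≡ Kernel v w)
free-code-is-kernel {m} C (φ , homomorphism , injective , onto , into) = normal , normal-unit , C≡Kernel
  where
  ψ : Word m → Word (suc m)
  ψ x = φ (x , [])
  open KernelPresentation (kernelPresentation ψ
    (λ x y → homomorphism (x , []) (y , [])) (λ x y eq → cong proj₁ (injective (x , []) (y , []) eq)))
  C⊆Kernel : ∀ w → C w ≡ true → Kernel normal w ≡ true
  C⊆Kernel w w∈C with onto w w∈C
  ... | (x , []) , ψx≡w = cong isZero (trans (cong (dot normal) (sym ψx≡w)) (annihilates x))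
  Kernel⊆C : ∀ w → Kernel normal w ≡ true → C w ≡ true
  Kernel⊆C w w∈K with cuts-out w (isZero⇒0 (dot normal w) w∈K)
  ... | x , ψx≡w = subst (λ z → C z ≡ true) ψx≡w (into (x , []))
  C≡Kernel : ∀ w → C w ≡ Kernel normal w
  C≡Kernel w = BoolP.⇔→≡ (mk⇔ (C⊆Kernel w) (Kernel⊆C w))

-- The monomial action on words and its adjoint on linear forms

signed : Bool → ℤ₄ → ℤ₄
signed true x = -₄ x
signed false x = x

if-signed : ∀ b x → (if b then -₄ x else x) ≡ signed b x
if-signed true x = refl
if-signed false x = refl

lookup-act : ∀ {n} (σ : Permutation′ n) s (w : Word n) i →
  lookup (act σ s w) i ≡ signed (lookup s i) (lookup w (σ ⟨$⟩ʳ i))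
lookup-act σ s w i = trans (VecP.lookup∘tabulate _ i) (if-signed (lookup s i) (lookup w (σ ⟨$⟩ʳ i)))

signed-swap : ∀ b d x → d *₄ signed b x ≡ signed b d *₄ x
signed-swap true = from-yes (all? λ d → all? λ x → d *₄ (-₄ x) ≟₄ (-₄ d) *₄ x)
signed-swap false d x = refl

-- the adjoint action: d·(act σ s w) = (coact σ s d)·w
coact : ∀ {n} → Permutation′ n → Vec Bool n → Word n → Word n
coact σ s d = tabulate λ k → signed (lookup s (σ ⟨$⟩ˡ k)) (lookup d (σ ⟨$⟩ˡ k))

dot-act : ∀ {n} (σ : Permutation′ n) s (d w : Word n) → dot d (act σ s w) ≡ dot (coact σ s d) w
dot-act σ s d w = begin
  dot d (act σ s w)                     ≡⟨ Σ₄.sum-cong-≗ move-sign ⟩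
  Σ₄.sum g                              ≡⟨ Σ₄.sum-permute g (Perm.flip σ) ⟩
  Σ₄.sum (λ k → g (σ ⟨$⟩ˡ k))           ≡⟨ Σ₄.sum-cong-≗ reindex ⟩
  dot (coact σ s d) w                   ∎
  where
  g : Fin _ → ℤ₄
  g i = signed (lookup s i) (lookup d i) *₄ lookup w (σ ⟨$⟩ʳ i)
  move-sign : ∀ i → lookup d i *₄ lookup (act σ s w) i ≡ g i
  move-sign i = trans (cong (lookup d i *₄_) (lookup-act σ s w i)) (signed-swap (lookup s i) (lookup d i) _)
  reindex : ∀ k → g (σ ⟨$⟩ˡ k) ≡ lookup (coact σ s d) k *₄ lookup w k
  reindex k = cong₂ _*₄_ (sym (VecP.lookup∘tabulate _ k)) (cong (lookup w) (Perm.inverseʳ σ))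

Kernel-act : ∀ {n} (σ : Permutation′ n) s (d w : Word n) → Kernel d (act σ s w) ≡ Kernel (coact σ s d) w
Kernel-act σ s d w = cong isZero (dot-act σ s d w)

-- Normal form of a linear form under the monomial action

standard : (n a b : ℕ) → Word n
standard zero a b = []
standard (suc n) (suc a) b = 1F ∷ standard n a b
standard (suc n) zero (suc b) = 2F ∷ standard n zero b
standard (suc n) zero zero = 0₄ ∷ standard n zero zero

isTwo : ℤ₄ → Bool
isTwo 2F = true
isTwo _ = false

isThree : ℤ₄ → Bool
isThree 3F = true
isThree _ = false

-- the representative 0, 1 or 2 of the orbit {x, -x}
orbitRep : ℤ₄ → ℤ₄
orbitRep 3F = 1F
orbitRep x = x

signed-orbitRep : ∀ x → signed (isThree x) (orbitRep x) ≡ x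
signed-orbitRep = from-yes (all? λ x → signed (isThree x) (orbitRep x) ≟₄ x)

indicator : Bool → ℕ
indicator true = 1
indicator false = 0

module Σℕ = Sum ℕP.+-0-commutativeMonoid

count : ∀ {n} → (ℤ₄ → Bool) → Word n → ℕ
count P v = Σℕ.sum (λ i → indicator (P (lookup v i)))

units twos : ∀ {n} → Word n → ℕ
units = count isUnit
twos = count isTwo

units+twos≤n : ∀ {n} (v : Word n) → units v + twos v ≤ n
units+twos≤n [] = z≤n
units+twos≤n (0F ∷ t) = ℕP.m≤n⇒m≤1+n (units+twos≤n t)
units+twos≤n (1F ∷ t) = s≤s (units+twos≤n t)
units+twos≤n {suc n} (2F ∷ t) = subst (_≤ suc n) (sym (ℕP.+-suc (units t) (twos t))) (s≤s (units+twos≤n t))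
units+twos≤n (3F ∷ t) = s≤s (units+twos≤n t)

standard-insert-two : ∀ n a b → a + b ≤ n → ∃[ p ] standard (suc n) a (suc b) ≡ insertAt (standard n a b) p 2F
standard-insert-two n zero b _ = 0F , refl
standard-insert-two (suc n) (suc a) b (s≤s a+b≤n) =
  let (p , eq) = standard-insert-two n a b a+b≤n in F.suc p , cong (1F ∷_) eq

standard-insert-zero : ∀ n a b → a + b ≤ n → ∃[ p ] standard (suc n) a b ≡ insertAt (standard n a b) p 0₄
standard-insert-zero zero zero zero _ = 0F , refl
standard-insert-zero (suc n) (suc a) b (s≤s a+b≤n) =
  let (p , eq) = standard-insert-zero n a b a+b≤n in F.suc p , cong (1F ∷_) eq
standard-insert-zero (suc n) zero (suc b) (s≤s b≤n) =
  let (p , eq) = standard-insert-zero n zero b b≤n in F.suc p , cong (2F ∷_) eq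
standard-insert-zero (suc n) zero zero _ = 0F , refl

insert-self : ∀ {m} (i j : Fin (suc m)) (π : Permutation′ m) → Perm.insert i j π ⟨$⟩ʳ i ≡ j
insert-self i j π with i FinP.≟ i
... | yes _ = refl
... | no i≢i = ⊥-elim (i≢i refl)

Sorting : ∀ {n} → (Word n) → (a b : ℕ) → Set
Sorting {n} x a b = Σ[ σ ∈ Permutation′ n ] ∀ i → orbitRep (lookup x (σ ⟨$⟩ʳ i)) ≡ lookup (standard n a b) i

sorting-step : ∀ {n} h (t : Word n) {a b A B} p →
  standard (suc n) A B ≡ insertAt (standard n a b) p (orbitRep h) → Sorting t a b → Sorting (h ∷ t) A B
sorting-step {n} h t {a} {b} {A} {B} p std≡ (σ , sorted) = ρ , sorted′
  where
  ρ : Permutation′ (suc n)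
  ρ = Perm.insert p 0F σ
  old new : Word (suc n)
  old = insertAt (standard n a b) p (orbitRep h)
  new = standard (suc n) A B
  InPlace : Fin (suc n) → Set
  InPlace i = orbitRep (lookup (h ∷ t) (ρ ⟨$⟩ʳ i)) ≡ lookup new i
  sorted′ : ∀ i → InPlace i
  sorted′ i with i FinP.≟ p
  ... | yes refl = begin
    orbitRep (lookup (h ∷ t) (ρ ⟨$⟩ʳ p))   ≡⟨ cong (orbitRep ∘ lookup (h ∷ t)) (insert-self p 0F σ) ⟩
    orbitRep h                             ≡⟨ VecP.insertAt-lookup (standard n a b) p (orbitRep h) ⟨
    lookup old p                           ≡⟨ cong (λ z → lookup z p) std≡ ⟨
    lookup new p                           ∎
  ... | no i≢p = subst InPlace (FinP.punchIn-punchOut p≢i) (begin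
    orbitRep (lookup (h ∷ t) (ρ ⟨$⟩ʳ punchIn p k))  ≡⟨ cong (orbitRep ∘ lookup (h ∷ t)) (Perm.insert-punchIn p 0F σ k) ⟩
    orbitRep (lookup t (σ ⟨$⟩ʳ k))                  ≡⟨ sorted k ⟩
    lookup (standard n a b) k                       ≡⟨ VecP.insertAt-punchIn (standard n a b) p (orbitRep h) k ⟨
    lookup old (punchIn p k)                        ≡⟨ cong (λ z → lookup z (punchIn p k)) std≡ ⟨
    lookup new (punchIn p k)                        ∎)
    where
    p≢i : p ≢ i
    p≢i p≡i = i≢p (sym p≡i)
    k : Fin n
    k = F.punchOut p≢i

sort : ∀ {n} (x : Word n) → Sorting x (units x) (twos x)
sort [] = Perm.id , λ ()
sort (0F ∷ t) = let (p , eq) = standard-insert-zero _ (units t) (twos t) (units+twos≤n t) in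
  sorting-step 0F t p eq (sort t)
sort (1F ∷ t) = sorting-step 1F t {A = suc (units t)} {B = twos t} 0F refl (sort t)
sort (2F ∷ t) = let (p , eq) = standard-insert-two _ (units t) (twos t) (units+twos≤n t) in
  sorting-step 2F t p eq (sort t)
sort (3F ∷ t) = sorting-step 3F t {A = suc (units t)} {B = twos t} 0F refl (sort t)

-- every linear form is the image of a standard one under the adjoint monomial action:
-- the signs record which coordinates are 3 rather than 1
normal-form : ∀ {n} (v : Word n) → ∃[ σ ] ∃[ s ] coact σ s (standard n (units v) (twos v)) ≡ v
normal-form {n} v = σ , s , trans (VecP.tabulate-cong pointwise) (VecP.tabulate∘lookup v)
  where
  σ : Permutation′ n
  σ = proj₁ (sort v)
  s : Vec Bool n
  s = tabulate (λ i → isThree (lookup v (σ ⟨$⟩ʳ i)))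
  std : Word n
  std = standard n (units v) (twos v)
  pointwise : ∀ k → signed (lookup s (σ ⟨$⟩ˡ k)) (lookup std (σ ⟨$⟩ˡ k)) ≡ lookup v k
  pointwise k = begin
    signed (lookup s j) (lookup std j)
      ≡⟨ cong₂ signed (VecP.lookup∘tabulate _ j) (sym (proj₂ (sort v) j)) ⟩
    signed (isThree (lookup v (σ ⟨$⟩ʳ j))) (orbitRep (lookup v (σ ⟨$⟩ʳ j)))
      ≡⟨ cong (λ i → signed (isThree (lookup v i)) (orbitRep (lookup v i))) (Perm.inverseʳ σ) ⟩
    signed (isThree (lookup v k)) (orbitRep (lookup v k))
      ≡⟨ signed-orbitRep (lookup v k) ⟩
    lookup v k ∎
    where
    j : Fin n
    j = σ ⟨$⟩ˡ k

-- the kernel of 1 ∷ d is the graph of x ↦ -(d·x)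
graph : ∀ {m} → Word m → Word m → Word (suc m)
graph d x = (-₄ (dot d x)) ∷ x

graph-in-kernel : ∀ {m} (d x : Word m) → Kernel (1F ∷ d) (graph d x) ≡ true
graph-in-kernel d x = cong isZero (cancel (dot d x))
  where
  cancel : ∀ a → (1F *₄ (-₄ a)) +₄ a ≡ 0₄
  cancel = from-yes (all? λ a → (1F *₄ (-₄ a)) +₄ a ≟₄ 0₄)

graph-onto : ∀ {m} (d : Word m) h w → Kernel (1F ∷ d) (h ∷ w) ≡ true → graph d w ≡ h ∷ w
graph-onto d h w hw∈K = cong (_∷ w) (sym (solve h (dot d w) (isZero⇒0 _ hw∈K)))
  where
  solve : ∀ h a → (1F *₄ h) +₄ a ≡ 0₄ → h ≡ -₄ a
  solve = from-yes (all? λ h → all? λ a → ((1F *₄ h) +₄ a ≟₄ 0₄) →-dec (h ≟₄ -₄ a))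

Kernel-type : ∀ {m} (d : Word m) → HasType (Kernel (1F ∷ d)) m 0
Kernel-type {m} d = φ , homomorphism , injective , onto , λ { (x , []) → graph-in-kernel d x }
  where
  φ : Grp m 0 → Word (suc m)
  φ (x , _) = graph d x
  homomorphism : ∀ x y → φ (x ⊞ y) ≡ φ x ⊕ φ y
  homomorphism (x , []) (y , []) =
    cong (_∷ (x ⊕ y)) (trans (cong -₄_ (dot-⊕ʳ d x y)) (-₄-distrib (dot d x) (dot d y)))
  injective : ∀ x y → φ x ≡ φ y → x ≡ y
  injective (x , []) (y , []) eq = cong (_, []) (cong V.tail eq)
  onto : ∀ w → Kernel (1F ∷ d) w ≡ true → ∃[ x ] φ x ≡ w
  onto (h ∷ w) hw∈K = (w , []) , graph-onto d h w hw∈K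

-- Codes of full support are not trivial extensions

last≡lookup-fromℕ : ∀ {A : Set} {n} (xs : Vec A (suc n)) → V.last xs ≡ lookup xs (fromℕ n)
last≡lookup-fromℕ (x ∷ []) = refl
last≡lookup-fromℕ (x ∷ y ∷ xs) = last≡lookup-fromℕ (y ∷ xs)

isZero-signed : ∀ b x → isZero (signed b x) ≡ isZero x
isZero-signed true = from-yes (all? λ x → isZero (-₄ x) BoolP.≟ isZero x)
isZero-signed false x = refl

isZero-act : ∀ {n} (σ : Permutation′ n) s (w : Word n) i →
  isZero (lookup (act σ s w) i) ≡ isZero (lookup w (σ ⟨$⟩ʳ i))
isZero-act σ s w i = trans (cong isZero (lookup-act σ s w i)) (isZero-signed (lookup s i) _)

isZero-last-act : ∀ {m} (σ : Permutation′ (suc m)) s (w : Word (suc m)) →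
  isZero (V.last (act σ s w)) ≡ isZero (lookup w (σ ⟨$⟩ʳ fromℕ m))
isZero-last-act {m} σ s w = trans (cong isZero (last≡lookup-fromℕ (act σ s w))) (isZero-act σ s w (fromℕ m))

∧-falseʳ : ∀ b → (b ∧ false) ≡ false
∧-falseʳ true = refl
∧-falseʳ false = refl

NotTrivial : ∀ m → Subset4 (suc m) → Set
NotTrivial m C = ¬ (∃[ C′ ] (IsCode {m} C′ × Equivalent (trivialExt C′) C))

-- a monomial image of a trivial extension vanishes identically at one coordinate,
-- so a code that is nonzero somewhere at every coordinate is not one
full-support⇒not-trivial : ∀ {m} (C : Subset4 (suc m)) →
  (∀ j → ∃[ w ] C w ≡ true × isZero (lookup w j) ≡ false) → NotTrivial m C
full-support⇒not-trivial {m} C support (C′ , _ , σ , s , C≡) with support (σ ⟨$⟩ʳ fromℕ m)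
... | w , w∈C , nonzero = true≢false (begin
  true                                                     ≡⟨ w∈C ⟨
  C w                                                      ≡⟨ C≡ w ⟩
  C′ (V.init (act σ s w)) ∧ isZero (V.last (act σ s w))    ≡⟨ cong (C′ (V.init (act σ s w)) ∧_) last-nonzero ⟩
  C′ (V.init (act σ s w)) ∧ false                          ≡⟨ ∧-falseʳ _ ⟩
  false                                                    ∎)
  where
  true≢false : ¬ (true ≡ false)
  true≢false ()
  last-nonzero : isZero (V.last (act σ s w)) ≡ false
  last-nonzero = trans (isZero-last-act σ s w) nonzero

-- The representatives: kernels of 1^(a+1) 2^b 0^(m-a-b) with 1 ≤ a + b ≤ m

Valid : ℕ → ℕ × ℕ → Set
Valid m (a , b) = 1 ≤ a + b × a + b ≤ m

rep : ∀ m → ℕ × ℕ → Subset4 (suc m)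
rep m (a , b) = Kernel (standard (suc m) (suc a) b)

lookup-e : ∀ {n} (k : Fin n) → lookup (e k) k ≡ 1F
lookup-e 0F = refl
lookup-e (F.suc k) = lookup-e k

standard-head-nonzero : ∀ n a b → 1 ≤ a + b → isZero (-₄ lookup (standard (suc n) a b) 0F) ≡ false
standard-head-nonzero n (suc a) b _ = refl
standard-head-nonzero n zero (suc b) _ = refl

-- graph (e k) is nonzero at coordinate k + 1, and graph e₀ at coordinate 0, whose entry is
-- minus the first entry 1 or 2 of the form
rep-full-support : ∀ m ab → Valid m ab → ∀ j → ∃[ w ] rep m ab w ≡ true × isZero (lookup w j) ≡ false
rep-full-support m (a , b) _ (F.suc k) =
  graph (standard m a b) (e k) , graph-in-kernel (standard m a b) (e k) , cong isZero (lookup-e k)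
rep-full-support (suc m) (a , b) (1≤a+b , _) 0F =
  graph (standard (suc m) a b) (e 0F) , graph-in-kernel (standard (suc m) a b) (e 0F) ,
  trans (cong (isZero ∘ -₄_) (dot-e (standard (suc m) a b) 0F)) (standard-head-nonzero m a b 1≤a+b)
rep-full-support zero (a , b) (1≤a+b , a+b≤0) 0F = ⊥-elim (ℕP.<-irrefl refl (ℕP.≤-trans 1≤a+b a+b≤0))

rep-counted : ∀ m ab → Valid m ab → Counted (suc m) m 0 (rep m ab)
rep-counted m (a , b) valid =
  Kernel-isCode (standard (suc m) (suc a) b) , Kernel-type (standard m a b) ,
  full-support⇒not-trivial (rep m (a , b)) (rep-full-support m (a , b) valid)

-- Distinctness: equivalent kernels have normals with equally many units and 2s

Kernel-e : ∀ {n} (v : Word n) j → Kernel v (e j) ≡ isZero (lookup v j)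
Kernel-e v j = cong isZero (dot-e v j)

Kernel-2e : ∀ {n} (v : Word n) j → Kernel v (2F · e j) ≡ isZero (2F *₄ lookup v j)
Kernel-2e v j = cong isZero (trans (dot-·ʳ v 2F (e j)) (cong (2F *₄_) (dot-e v j)))

unit-from-profile : ∀ x y → isZero x ≡ isZero y → isZero (2F *₄ x) ≡ isZero (2F *₄ y) →
  isUnit x ≡ isUnit y
unit-from-profile = from-yes (all? λ x → all? λ y →
  (isZero x BoolP.≟ isZero y) →-dec (isZero (2F *₄ x) BoolP.≟ isZero (2F *₄ y)) →-dec
  (isUnit x BoolP.≟ isUnit y))

two-from-profile : ∀ x y → isZero x ≡ isZero y → isZero (2F *₄ x) ≡ isZero (2F *₄ y) →
  isTwo x ≡ isTwo y
two-from-profile = from-yes (all? λ x → all? λ y →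
  (isZero x BoolP.≟ isZero y) →-dec (isZero (2F *₄ x) BoolP.≟ isZero (2F *₄ y)) →-dec
  (isTwo x BoolP.≟ isTwo y))

count-coact : ∀ {n} (P : ℤ₄ → Bool) → (∀ x → P (-₄ x) ≡ P x) →
  ∀ (σ : Permutation′ n) s c → count P (coact σ s c) ≡ count P c
count-coact P P-even σ s c = begin
  count P (coact σ s c)          ≡⟨ Σℕ.sum-cong-≗ unsign ⟩
  Σℕ.sum (λ k → f (σ ⟨$⟩ˡ k))    ≡⟨ Σℕ.sum-permute f (Perm.flip σ) ⟨
  count P c                      ∎
  where
  f : Fin _ → ℕ
  f i = indicator (P (lookup c i))
  P-signed : ∀ b x → P (signed b x) ≡ P x
  P-signed true x = P-even x
  P-signed false x = refl
  unsign : ∀ k → indicator (P (lookup (coact σ s c) k)) ≡ f (σ ⟨$⟩ˡ k)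
  unsign k = cong indicator (trans (cong P (VecP.lookup∘tabulate _ k)) (P-signed (lookup s (σ ⟨$⟩ˡ k)) _))

-- equal kernels have normals vanishing, and vanishing after doubling, at the same coordinates
equal-kernels : ∀ {n} (c d : Word n) → (∀ w → Kernel d w ≡ Kernel c w) →
  units d ≡ units c × twos d ≡ twos c
equal-kernels c d same =
    Σℕ.sum-cong-≗ (λ j → cong indicator (unit-from-profile _ _ (zero-at j) (twice-zero-at j)))
  , Σℕ.sum-cong-≗ (λ j → cong indicator (two-from-profile _ _ (zero-at j) (twice-zero-at j)))
  where
  zero-at : ∀ j → isZero (lookup d j) ≡ isZero (lookup c j)
  zero-at j = trans (sym (Kernel-e d j)) (trans (same (e j)) (Kernel-e c j))
  twice-zero-at : ∀ j → isZero (2F *₄ lookup d j) ≡ isZero (2F *₄ lookup c j)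
  twice-zero-at j = trans (sym (Kernel-2e d j)) (trans (same (2F · e j)) (Kernel-2e c j))

equivalent-kernels : ∀ {n} (c d : Word n) → Equivalent (Kernel c) (Kernel d) →
  units c ≡ units d × twos c ≡ twos d
equivalent-kernels c d (σ , s , d≡c∘act) =
    trans (sym (count-coact isUnit isUnit-neg σ s c)) (sym (proj₁ counts))
  , trans (sym (count-coact isTwo isTwo-neg σ s c)) (sym (proj₂ counts))
  where
  counts : units d ≡ units (coact σ s c) × twos d ≡ twos (coact σ s c)
  counts = equal-kernels (coact σ s c) d (λ w → trans (d≡c∘act w) (Kernel-act σ s c w))
  isUnit-neg : ∀ x → isUnit (-₄ x) ≡ isUnit x
  isUnit-neg = from-yes (all? λ x → isUnit (-₄ x) BoolP.≟ isUnit x)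
  isTwo-neg : ∀ x → isTwo (-₄ x) ≡ isTwo x
  isTwo-neg = from-yes (all? λ x → isTwo (-₄ x) BoolP.≟ isTwo x)

count-standard : ∀ n a b → a + b ≤ n → units (standard n a b) ≡ a × twos (standard n a b) ≡ b
count-standard zero zero zero z≤n = refl , refl
count-standard (suc n) (suc a) b (s≤s a+b≤n) =
  let (ua , tb) = count-standard n a b a+b≤n in cong suc ua , tb
count-standard (suc n) zero (suc b) (s≤s b≤n) =
  let (ua , tb) = count-standard n zero b b≤n in ua , cong suc tb
count-standard (suc n) zero zero z≤n = count-standard n zero zero z≤n

rep-distinct : ∀ m ab ab′ → Valid m ab → Valid m ab′ → Equivalent (rep m ab) (rep m ab′) → ab ≡ ab′
rep-distinct m (a , b) (a′ , b′) (_ , a+b≤m) (_ , a′+b′≤m) equivalent = cong₂ _,_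
  (ℕP.suc-injective (trans (sym (proj₁ std)) (trans (proj₁ invariants) (proj₁ std′))))
  (trans (sym (proj₂ std)) (trans (proj₂ invariants) (proj₂ std′)))
  where
  invariants : units (standard (suc m) (suc a) b) ≡ units (standard (suc m) (suc a′) b′)
             × twos (standard (suc m) (suc a) b) ≡ twos (standard (suc m) (suc a′) b′)
  invariants = equivalent-kernels (standard (suc m) (suc a) b) (standard (suc m) (suc a′) b′) equivalent
  std : units (standard (suc m) (suc a) b) ≡ suc a × twos (standard (suc m) (suc a) b) ≡ b
  std = count-standard (suc m) (suc a) b (s≤s a+b≤m)
  std′ : units (standard (suc m) (suc a′) b′) ≡ suc a′ × twos (standard (suc m) (suc a′) b′) ≡ b′
  std′ = count-standard (suc m) (suc a′) b′ (s≤s a′+b′≤m)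

-- Classification: every counted code is equivalent to a representative

kernel-equivalence : ∀ {n} (C : Subset4 n) σ s (c : Word n) →
  (∀ w → C w ≡ Kernel (coact σ s c) w) → Equivalent (Kernel c) C
kernel-equivalence C σ s c C≡ = σ , s , λ w → trans (C≡ w) (sym (Kernel-act σ s c w))

units-positive : ∀ {n} (v : Word n) → HasUnit v → 1 ≤ units v
units-positive (1F ∷ v) (0F , _) = s≤s z≤n
units-positive (3F ∷ v) (0F , _) = s≤s z≤n
units-positive (x ∷ v) (F.suc k , unit) = ℕP.≤-trans (units-positive v (k , unit)) (ℕP.m≤n+m (units v) _)

dot-standard-zeros : ∀ n (w : Word n) → dot (standard n 0 0) w ≡ 0₄
dot-standard-zeros zero [] = refl
dot-standard-zeros (suc n) (y ∷ w) = trans (cong₂ _+₄_ (*₄-zeroˡ y) (dot-standard-zeros n w)) (+₄-identityˡ 0₄)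

transpose-self : ∀ {n} (i j : Fin n) → Perm.transpose i j ⟨$⟩ʳ i ≡ j
transpose-self i j with i FinP.≟ i
... | yes _ = refl
... | no i≢i = ⊥-elim (i≢i refl)

-- the kernel of 1 0 ⋯ 0 is, after moving coordinate 0 to the end, the trivial extension of the full code
hyperplane-is-trivial : ∀ m (C : Subset4 (suc m)) → Equivalent (Kernel (standard (suc m) 1 0)) C →
  Equivalent (trivialExt {m} (λ _ → true)) C
hyperplane-is-trivial m C (σ , s , C≡) = τ , unsigned , λ w → trans (C≡ w) (same-test w)
  where
  τ : Permutation′ (suc m)
  τ = Perm.transpose (fromℕ m) 0F Perm.∘ₚ σ
  unsigned : Vec Bool (suc m)
  unsigned = replicate (suc m) false
  first-coordinate : ∀ w → dot (standard (suc m) 1 0) w ≡ lookup w 0F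
  first-coordinate (y ∷ w) = trans (cong₂ _+₄_ (*₄-identityˡ y) (dot-standard-zeros m w)) (+₄-identityʳ y)
  same-test : ∀ w → Kernel (standard (suc m) 1 0) (act σ s w) ≡ isZero (V.last (act τ unsigned w))
  same-test w = begin
    isZero (dot (standard (suc m) 1 0) (act σ s w))   ≡⟨ cong isZero (first-coordinate (act σ s w)) ⟩
    isZero (lookup (act σ s w) 0F)                    ≡⟨ isZero-act σ s w 0F ⟩
    isZero (lookup w (σ ⟨$⟩ʳ 0F))                     ≡⟨ cong (λ i → isZero (lookup w (σ ⟨$⟩ʳ i))) τ-last ⟨
    isZero (lookup w (τ ⟨$⟩ʳ fromℕ m))                ≡⟨ isZero-last-act τ unsigned w ⟨
    isZero (V.last (act τ unsigned w))                ∎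
    where
    τ-last : Perm.transpose (fromℕ m) 0F ⟨$⟩ʳ fromℕ m ≡ 0F
    τ-last = transpose-self (fromℕ m) 0F

full-isCode : ∀ {m} → IsCode {m} (λ _ → true)
full-isCode = record { has-zero = refl ; closed-+ = λ _ _ _ _ → refl ; closed-· = λ _ _ _ → refl }

classify-standard : ∀ m C A B → Equivalent (Kernel (standard (suc m) A B)) C → 1 ≤ A → A + B ≤ suc m →
  NotTrivial m C → ∃[ ab ] Valid m ab × Equivalent (rep m ab) C
classify-standard m C (suc zero) zero equivalent _ _ not-trivial =
  ⊥-elim (not-trivial ((λ _ → true) , full-isCode , hyperplane-is-trivial m C equivalent))
classify-standard m C (suc zero) (suc b) equivalent _ (s≤s b<m) _ = (0 , suc b) , (s≤s z≤n , b<m) , equivalent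
classify-standard m C (suc (suc a)) b equivalent _ (s≤s a+b<m) _ = (suc a , b) , (s≤s z≤n , a+b<m) , equivalent

-- a counted code is a kernel (free-code-is-kernel) of a form equivalent to a standard one (normal-form)
classify : ∀ m C → Counted (suc m) m 0 C → ∃[ ab ] Valid m ab × Equivalent (rep m ab) C
classify m C (_ , type , not-trivial) =
  classify-standard m C (units v) (twos v) (kernel-equivalence C σ s std C≡coact)
    (units-positive v v-unit) (units+twos≤n v) not-trivial
  where
  presentation : ∃[ v ] HasUnit v × (∀ w → C w ≡ Kernel v w)
  presentation = free-code-is-kernel C type
  v : Word (suc m)
  v = proj₁ presentation
  v-unit : HasUnit v
  v-unit = proj₁ (proj₂ presentation)
  normal : ∃[ σ ] ∃[ s ] coact σ s (standard (suc m) (units v) (twos v)) ≡ v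
  normal = normal-form v
  σ : Permutation′ (suc m)
  σ = proj₁ normal
  s : Vec Bool (suc m)
  s = proj₁ (proj₂ normal)
  std : Word (suc m)
  std = standard (suc m) (units v) (twos v)
  C≡coact : ∀ w → C w ≡ Kernel (coact σ s std) w
  C≡coact w = trans (proj₂ (proj₂ presentation) w) (cong (λ z → Kernel z w) (sym (proj₂ (proj₂ normal))))

record Enumeration {I : Set} (P : I → Set) (N : ℕ) : Set where
  field
    index      : Fin N → I
    valid      : ∀ i → P (index i)
    injective  : ∀ i j → index i ≡ index j → i ≡ j
    surjective : ∀ x → P x → ∃[ i ] index i ≡ x

union-enumeration : ∀ {I : Set} {P Q R : I → Set} {N M} →
  (∀ x → R x → P x ⊎ Q x) → (∀ x → P x → R x) → (∀ x → Q x → R x) → (∀ x → P x → ¬ Q x) →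
  Enumeration P N → Enumeration Q M → Enumeration R (N + M)
union-enumeration {I} {P} {Q} {R} {N} {M} split P⇒R Q⇒R disjoint EP EQ = record
  { index = index⊎ ∘ splitAt N
  ; valid = valid⊎ ∘ splitAt N
  ; injective = λ i j eq → trans (sym (FinP.join-splitAt N M i))
      (trans (cong (F.join N M) (injective⊎ (splitAt N i) (splitAt N j) eq)) (FinP.join-splitAt N M j))
  ; surjective = surjective′
  }
  where
  module EP = Enumeration EP
  module EQ = Enumeration EQ
  index⊎ : Fin N ⊎ Fin M → I
  index⊎ = [ EP.index , EQ.index ]′
  valid⊎ : ∀ s → R (index⊎ s)
  valid⊎ (inj₁ i) = P⇒R _ (EP.valid i)
  valid⊎ (inj₂ j) = Q⇒R _ (EQ.valid j)
  injective⊎ : ∀ s t → index⊎ s ≡ index⊎ t → s ≡ t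
  injective⊎ (inj₁ i) (inj₁ i′) eq = cong inj₁ (EP.injective i i′ eq)
  injective⊎ (inj₂ j) (inj₂ j′) eq = cong inj₂ (EQ.injective j j′ eq)
  injective⊎ (inj₁ i) (inj₂ j) eq = ⊥-elim (disjoint _ (EP.valid i) (subst Q (sym eq) (EQ.valid j)))
  injective⊎ (inj₂ j) (inj₁ i) eq = ⊥-elim (disjoint _ (EP.valid i) (subst Q eq (EQ.valid j)))
  surjective′ : ∀ x → R x → ∃[ i ] index⊎ (splitAt N i) ≡ x
  surjective′ x Rx with split x Rx
  ... | inj₁ Px = let (i , eq) = EP.surjective x Px in i ↑ˡ M , trans (cong index⊎ (FinP.splitAt-↑ˡ N i M)) eq
  ... | inj₂ Qx = let (j , eq) = EQ.surjective x Qx in N ↑ʳ j , trans (cong index⊎ (FinP.splitAt-↑ʳ N M j)) eq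

OnLayer : ℕ → ℕ × ℕ → Set
OnLayer k (a , b) = a + b ≡ suc k

layer-enumeration : ∀ k → Enumeration (OnLayer k) (suc (suc k))
layer-enumeration k = record
  { index = λ j → toℕ j , suc k ∸ toℕ j
  ; valid = λ j → ℕP.m+[n∸m]≡n (ℕP.≤-pred (FinP.toℕ<n j))
  ; injective = λ i j eq → FinP.toℕ-injective (cong proj₁ eq)
  ; surjective = surjective
  }
  where
  surjective : ∀ x → OnLayer k x → ∃[ j ] (toℕ j , suc k ∸ toℕ j) ≡ x
  surjective (a , b) a+b≡ = fromℕ< (s≤s a≤) , cong₂ _,_ (FinP.toℕ-fromℕ< (s≤s a≤)) (begin
    suc k ∸ toℕ (fromℕ< (s≤s a≤))  ≡⟨ cong (suc k ∸_) (FinP.toℕ-fromℕ< (s≤s a≤)) ⟩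
    suc k ∸ a                       ≡⟨ cong (_∸ a) a+b≡ ⟨
    a + b ∸ a                       ≡⟨ ℕP.m+n∸m≡n a b ⟩
    b                               ∎)
    where
    a≤ : a ≤ suc k
    a≤ = subst (a ≤_) a+b≡ (ℕP.m≤m+n a b)

-- the number of pairs (a , b) with 1 ≤ a + b ≤ k
pairCount : ℕ → ℕ
pairCount zero = 0
pairCount (suc k) = pairCount k + suc (suc k)

-- the valid pairs for k + 1 are those for k together with the layer a + b = k + 1
pair-enumeration : ∀ k → Enumeration (Valid k) (pairCount k)
pair-enumeration zero = record
  { index = λ () ; valid = λ () ; injective = λ ()
  ; surjective = λ _ (1≤s , s≤0) → ⊥-elim (ℕP.<-irrefl refl (ℕP.≤-trans 1≤s s≤0)) }
pair-enumeration (suc k) = union-enumeration split below on-layer disjoint (pair-enumeration k) (layer-enumeration k)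
  where
  split : ∀ x → Valid (suc k) x → Valid k x ⊎ OnLayer k x
  split (a , b) (1≤s , s≤1+k) with ℕP.m≤n⇒m<n∨m≡n s≤1+k
  ... | inj₁ (s≤s s≤k) = inj₁ (1≤s , s≤k)
  ... | inj₂ s≡1+k = inj₂ s≡1+k
  below : ∀ x → Valid k x → Valid (suc k) x
  below _ (1≤s , s≤k) = 1≤s , ℕP.m≤n⇒m≤1+n s≤k
  on-layer : ∀ x → OnLayer k x → Valid (suc k) x
  on-layer _ s≡1+k = subst (λ s → 1 ≤ s × s ≤ suc k) (sym s≡1+k) (s≤s z≤n , ℕP.≤-refl)
  disjoint : ∀ x → Valid k x → ¬ OnLayer k x
  disjoint _ (_ , s≤k) s≡1+k = ℕP.1+n≰n (subst (_≤ k) s≡1+k s≤k)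

pairCount-doubled : ∀ m → suc m * (suc m + 1) ≡ (pairCount m + 1) * 2
pairCount-doubled zero = refl
pairCount-doubled (suc m) = begin
  suc (suc m) * (suc (suc m) + 1)         ≡⟨ next-triangle m ⟩
  suc m * (suc m + 1) + 2 * suc (suc m)   ≡⟨ cong (_+ 2 * suc (suc m)) (pairCount-doubled m) ⟩
  (pairCount m + 1) * 2 + 2 * suc (suc m) ≡⟨ regroup (pairCount m) (suc (suc m)) ⟩
  (pairCount (suc m) + 1) * 2             ∎
  where
  open +-*-Solver
  next-triangle : ∀ m → suc (suc m) * (suc (suc m) + 1) ≡ suc m * (suc m + 1) + 2 * suc (suc m)
  next-triangle = solve 1 (λ m → (con 2 :+ m) :* ((con 2 :+ m) :+ con 1)
                               := (con 1 :+ m) :* ((con 1 :+ m) :+ con 1) :+ con 2 :* (con 2 :+ m)) refl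
  regroup : ∀ t s → (t + 1) * 2 + 2 * s ≡ (t + s + 1) * 2
  regroup = solve 2 (λ t s → (t :+ con 1) :* con 2 :+ con 2 :* s := (t :+ s :+ con 1) :* con 2) refl

pairCount-formula : ∀ m → pairCount m ≡ (suc m * (suc m + 1)) / 2 ∸ 1
pairCount-formula m = sym (begin
  (suc m * (suc m + 1)) / 2 ∸ 1     ≡⟨ cong (λ z → z / 2 ∸ 1) (pairCount-doubled m) ⟩
  ((pairCount m + 1) * 2) / 2 ∸ 1   ≡⟨ cong (_∸ 1) (m*n/n≡m (pairCount m + 1) 2) ⟩
  pairCount m + 1 ∸ 1               ≡⟨ ℕP.m+n∸n≡m (pairCount m) 1 ⟩
  pairCount m                       ∎)

classification⇒N′ : ∀ {n k₁ k₂ N} {I : Set} {P : I → Set} (E : Enumeration P N) (rep : I → Subset4 n) →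
  (∀ x → P x → Counted n k₁ k₂ (rep x)) →
  (∀ x y → P x → P y → Equivalent (rep x) (rep y) → x ≡ y) →
  (∀ C → Counted n k₁ k₂ C → ∃[ x ] P x × Equivalent (rep x) C) →
  N'≡ n k₁ k₂ N
classification⇒N′ {n} {k₁} {k₂} E rep counted distinct complete = reps , counted′ , distinct′ , complete′
  where
  open Enumeration E
  reps : Vec (Subset4 n) _
  reps = tabulate (rep ∘ index)
  lookup-reps : ∀ i → lookup reps i ≡ rep (index i)
  lookup-reps i = VecP.lookup∘tabulate (rep ∘ index) i
  counted′ : ∀ i → Counted n k₁ k₂ (lookup reps i)
  counted′ i = subst (Counted n k₁ k₂) (sym (lookup-reps i)) (counted (index i) (valid i))
  distinct′ : ∀ i j → i ≢ j → ¬ Equivalent (lookup reps i) (lookup reps j)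
  distinct′ i j i≢j equivalent = i≢j (injective i j (distinct (index i) (index j) (valid i) (valid j)
    (subst₂ Equivalent (lookup-reps i) (lookup-reps j) equivalent)))
  complete′ : ∀ C → Counted n k₁ k₂ C → ∃[ i ] Equivalent (lookup reps i) C
  complete′ C counted-C =
    let (x , Px , equivalent) = complete C counted-C
        (i , index-i≡x) = surjective x Px
    in i , subst (λ D → Equivalent D C) (sym (trans (lookup-reps i) (cong rep index-i≡x))) equivalent

proposition4p6 : ∀ (m : ℕ) → N'≡ (suc m) m 0 (((suc m) * (suc m + 1)) / 2 ∸ 1)
proposition4p6 m = subst (N'≡ (suc m) m 0) (pairCount-formula m)
  (classification⇒N′ (pair-enumeration m) (rep m) (rep-counted m) (rep-distinct m) (classify m))
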